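{- The reduction relation $\rightarrow_{\beta\pi\mu}$ of $\lambda\mathbf{J}^{\mathbf{m}}$ is confluent.
   Context: $\lambda\mathbf{J}^{\mathbf m}$: terms $t,u,v::=x\mid\lambda x.t\mid t(u,l)$; co-terms $l::=u::l\mid(x)v$ ($(x)$ binds $x$ in $v$; capture-avoiding substitution). A value $V$ is a variable or a $\lambda$-abstraction. Generalised arguments $R,S$ are pairs $(u,l)$; $tRS$ means $(tR)S$. Append: $(u::l)@S=u::(l@S)$, $((x)V)@S=(x)(VS)$ for $V$ a value, $((x)t(u,l))@S=(x)t(u,l@S)$, and $(u,l)@S=(u,l@S)$. The reduction is the closure under all constructors of: $(\beta_1)\ (\lambda x.t)(u,(y)v)\rightarrow[[u/x]t/y]v$; $(\beta_2)\ (\lambda x.t)(u,v::l)\rightarrow([u/x]t)(v,l)$; $(\pi)\ tRS\rightarrow t(R@S)$; $(\mu)\ (x)x(u,l)\rightarrow u::l$ if $x$ is free in neither $u$ nor $l$; $\beta=\beta_1\cup\beta_2$. Confluence: whenever $t\rightarrow^*t_1$ and $t\rightarrow^*t_2$ there is $t_3$ with $t_i\rightarrow^*t_3$. -}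

module Defs where

-- Syntax of λJ^m with well-scoped de Bruijn indices: Tm n / CoTm n are the
-- terms / co-terms whose free variables are among n.

open import Data.Nat using (ℕ; zero; suc)
open import Data.Fin using (Fin; zero; suc)
open import Data.Product using (∃; _×_; _,_)
open import Relation.Binary.Construct.Closure.ReflexiveTransitive using (Star)

mutual
  data Tm (n : ℕ) : Set where
    var : Fin n → Tm n
    lam : Tm (suc n) → Tm n
    app : Tm n → Tm n → CoTm n → Tm n       -- t(u,l)

  data CoTm (n : ℕ) : Set where
    _∷_ : Tm n → CoTm n → CoTm n
    abs : Tm (suc n) → CoTm n               -- (x)v

infixr 5 _∷_

Ren : ℕ → ℕ → Set
Ren m n = Fin m → Fin n

liftR : ∀ {m n} → Ren m n → Ren (suc m) (suc n)
liftR ρ zero = zero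
liftR ρ (suc i) = suc (ρ i)

mutual
  ren : ∀ {m n} → Ren m n → Tm m → Tm n
  ren ρ (var i) = var (ρ i)
  ren ρ (lam t) = lam (ren (liftR ρ) t)
  ren ρ (app t u l) = app (ren ρ t) (ren ρ u) (renC ρ l)

  renC : ∀ {m n} → Ren m n → CoTm m → CoTm n
  renC ρ (u ∷ l) = ren ρ u ∷ renC ρ l
  renC ρ (abs v) = abs (ren (liftR ρ) v)

wk : ∀ {n} → Tm n → Tm (suc n)
wk = ren suc

wkC : ∀ {n} → CoTm n → CoTm (suc n)
wkC = renC suc

Sub : ℕ → ℕ → Set
Sub m n = Fin m → Tm n

liftS : ∀ {m n} → Sub m n → Sub (suc m) (suc n)
liftS σ zero = var zero
liftS σ (suc i) = wk (σ i)

mutual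
  sub : ∀ {m n} → Sub m n → Tm m → Tm n
  sub σ (var i) = σ i
  sub σ (lam t) = lam (sub (liftS σ) t)
  sub σ (app t u l) = app (sub σ t) (sub σ u) (subC σ l)

  subC : ∀ {m n} → Sub m n → CoTm m → CoTm n
  subC σ (u ∷ l) = sub σ u ∷ subC σ l
  subC σ (abs v) = abs (sub (liftS σ) v)

-- single substitution [u/x]t, x the outermost bound variable (index 0)
single : ∀ {n} → Tm n → Sub (suc n) n
single u zero = u
single u (suc i) = var i

_[_] : ∀ {n} → Tm (suc n) → Tm n → Tm n
t [ u ] = sub (single u) t

-- Append l ⊕ S where S = (u', l') is a generalised argument.
-- Under the binder (x) the argument S is weakened (capture avoidance).
-- ((x)V)@S = (x)(V S) for V a value (variable or abstraction);
-- ((x)t(u,l))@S = (x)t(u,l@S).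
_⊕_ : ∀ {n} → CoTm n → Tm n × CoTm n → CoTm n
(u ∷ l) ⊕ S = u ∷ (l ⊕ S)
abs (var i) ⊕ (u' , l') = abs (app (var i) (wk u') (wkC l'))
abs (lam t) ⊕ (u' , l') = abs (app (lam t) (wk u') (wkC l'))
abs (app t u l) ⊕ (u' , l') = abs (app t u (l ⊕ (wk u' , wkC l')))

infixr 5 _⊕_

mutual
  data _⟶_ {n : ℕ} : Tm n → Tm n → Set where
    β₁ : ∀ {t u v} → app (lam t) u (abs v) ⟶ (v [ t [ u ] ])
    β₂ : ∀ {t u v l} → app (lam t) u (v ∷ l) ⟶ app (t [ u ]) v l
    π  : ∀ {t u l u' l'} → app (app t u l) u' l' ⟶ app t u (l ⊕ (u' , l'))
    ξ-lam  : ∀ {t t'} → t ⟶ t' → lam t ⟶ lam t'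
    ξ-app₁ : ∀ {t t' u l} → t ⟶ t' → app t u l ⟶ app t' u l
    ξ-app₂ : ∀ {t u u' l} → u ⟶ u' → app t u l ⟶ app t u' l
    ξ-app₃ : ∀ {t u l l'} → l ⟶C l' → app t u l ⟶ app t u l'

  data _⟶C_ {n : ℕ} : CoTm n → CoTm n → Set where
    -- μ: (x)x(u,l) → u::l when x is free in neither u nor l, i.e. u, l are
    -- weakenings of terms u₀, l₀ of the outer scope.
    μ : ∀ {u l} → abs (app (var zero) (wk u) (wkC l)) ⟶C (u ∷ l)
    ξ-∷₁  : ∀ {u u' l} → u ⟶ u' → (u ∷ l) ⟶C (u' ∷ l)
    ξ-∷₂  : ∀ {u l l'} → l ⟶C l' → (u ∷ l) ⟶C (u ∷ l')
    ξ-abs : ∀ {v v'} → v ⟶ v' → abs v ⟶C abs v'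

infix 4 _⟶_ _⟶C_ _⟶*_

_⟶*_ : ∀ {n} → Tm n → Tm n → Set
_⟶*_ = Star _⟶_

Confluent : Set
Confluent = ∀ {n} {t t₁ t₂ : Tm n} → t ⟶* t₁ → t ⟶* t₂ →
            ∃ λ t₃ → (t₁ ⟶* t₃) × (t₂ ⟶* t₃)

-- The πμ-rules have a normal form computed by a function nf: appNF and appendNF
-- merge a generalised argument into the head, and absμ contracts a μ-redex as soon
-- as one appears.  Every term πμ-reduces to nf t, and nf is invariant under
-- πμ-steps.  β is handled by Tait–Martin-Löf parallel reduction ⇉ with its complete
-- development.  The crux is that ⇉ projects onto πμ-normal forms: t ⇉ t' gives
-- nf t ⇉ c with nf c ≡ nf t'.  Hence "a ⇉-step followed by nf" has the diamond
-- property, every ⟶-step becomes zero or one such step between normal forms, and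
-- each such step is a ⟶-reduction; confluence of ⟶ follows.

module Submission where

open import Defs
open import Data.Nat using (ℕ; zero; suc)
open import Data.Fin using (Fin; zero; suc)
open import Data.Product using (∃; _×_; _,_; uncurry; map)
open import Data.Sum using (_⊎_; inj₁; inj₂) renaming (map to map⊎)
open import Data.Maybe using (Maybe; just; nothing; zip; zipWith)
  renaming (map to mapᴹ)
open import Function using (_∘_; id)
open import Relation.Binary.PropositionalEquality hiding ([_])
open ≡-Reasoning
open import Relation.Binary.Construct.Closure.ReflexiveTransitive
  using (Star; ε; _◅_; _◅◅_; gmap; return)
import Relation.Binary.Rewriting as Rewriting

cong₃ : ∀ {A B C D : Set} (f : A → B → C → D) {a a' b b' c c'} →
        a ≡ a' → b ≡ b' → c ≡ c' → f a b c ≡ f a' b' c'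
cong₃ f refl refl refl = refl

Diamond : ∀ {A : Set} → (A → A → Set) → Set
Diamond _▷_ = ∀ {x y₁ y₂} → x ▷ y₁ → x ▷ y₂ → ∃ λ z → y₁ ▷ z × y₂ ▷ z

module _ {A : Set} {_▷_ : A → A → Set} (◇ : Diamond _▷_) where

  strip : ∀ {x y₁ y₂} → x ▷ y₁ → Star _▷_ x y₂ → ∃ λ z → Star _▷_ y₁ z × y₂ ▷ z
  strip s ε = _ , ε , s
  strip s (s' ◅ ss) with ◇ s s'
  ... | _ , a , b with strip b ss
  ... | z , c , e = z , a ◅ c , e

  diamond⇒confluent : Rewriting.Confluent _▷_
  diamond⇒confluent ε ss₂ = _ , ss₂ , ε
  diamond⇒confluent (s ◅ ss₁) ss₂ with strip s ss₂
  ... | _ , a , b with diamond⇒confluent ss₁ a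
  ... | z , c , e = z , c , b ◅ e

-- Renaming and substitution

liftR-cong : ∀ {m n} {ρ ρ' : Ren m n} → (∀ i → ρ i ≡ ρ' i) → ∀ i → liftR ρ i ≡ liftR ρ' i
liftR-cong e zero = refl
liftR-cong e (suc i) = cong suc (e i)

mutual
  ren-cong : ∀ {m n} {ρ ρ' : Ren m n} → (∀ i → ρ i ≡ ρ' i) → ∀ t → ren ρ t ≡ ren ρ' t
  ren-cong e (var i) = cong var (e i)
  ren-cong e (lam t) = cong lam (ren-cong (liftR-cong e) t)
  ren-cong e (app t u l) = cong₃ app (ren-cong e t) (ren-cong e u) (renC-cong e l)

  renC-cong : ∀ {m n} {ρ ρ' : Ren m n} → (∀ i → ρ i ≡ ρ' i) → ∀ l → renC ρ l ≡ renC ρ' l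
  renC-cong e (u ∷ l) = cong₂ _∷_ (ren-cong e u) (renC-cong e l)
  renC-cong e (abs v) = cong abs (ren-cong (liftR-cong e) v)

liftR-id : ∀ {n} (i : Fin (suc n)) → liftR id i ≡ i
liftR-id zero = refl
liftR-id (suc i) = refl

mutual
  ren-id : ∀ {n} (t : Tm n) → ren id t ≡ t
  ren-id (var i) = refl
  ren-id (lam t) = cong lam (trans (ren-cong liftR-id t) (ren-id t))
  ren-id (app t u l) = cong₃ app (ren-id t) (ren-id u) (renC-id l)

  renC-id : ∀ {n} (l : CoTm n) → renC id l ≡ l
  renC-id (u ∷ l) = cong₂ _∷_ (ren-id u) (renC-id l)
  renC-id (abs v) = cong abs (trans (ren-cong liftR-id v) (ren-id v))

liftR-∘ : ∀ {k m n} (ρ : Ren m n) (ρ' : Ren k m) i → liftR ρ (liftR ρ' i) ≡ liftR (ρ ∘ ρ') i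
liftR-∘ ρ ρ' zero = refl
liftR-∘ ρ ρ' (suc i) = refl

mutual
  ren-∘ : ∀ {k m n} (ρ : Ren m n) (ρ' : Ren k m) t → ren ρ (ren ρ' t) ≡ ren (ρ ∘ ρ') t
  ren-∘ ρ ρ' (var i) = refl
  ren-∘ ρ ρ' (lam t) = cong lam (trans (ren-∘ (liftR ρ) (liftR ρ') t) (ren-cong (liftR-∘ ρ ρ') t))
  ren-∘ ρ ρ' (app t u l) = cong₃ app (ren-∘ ρ ρ' t) (ren-∘ ρ ρ' u) (renC-∘ ρ ρ' l)

  renC-∘ : ∀ {k m n} (ρ : Ren m n) (ρ' : Ren k m) l → renC ρ (renC ρ' l) ≡ renC (ρ ∘ ρ') l
  renC-∘ ρ ρ' (u ∷ l) = cong₂ _∷_ (ren-∘ ρ ρ' u) (renC-∘ ρ ρ' l)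
  renC-∘ ρ ρ' (abs v) = cong abs (trans (ren-∘ (liftR ρ) (liftR ρ') v) (ren-cong (liftR-∘ ρ ρ') v))

ren-wk : ∀ {m n} (ρ : Ren m n) t → ren (liftR ρ) (wk t) ≡ wk (ren ρ t)
ren-wk ρ t = trans (ren-∘ (liftR ρ) suc t) (sym (ren-∘ suc ρ t))

renC-wkC : ∀ {m n} (ρ : Ren m n) l → renC (liftR ρ) (wkC l) ≡ wkC (renC ρ l)
renC-wkC ρ l = trans (renC-∘ (liftR ρ) suc l) (sym (renC-∘ suc ρ l))

liftS-cong : ∀ {m n} {σ σ' : Sub m n} → (∀ i → σ i ≡ σ' i) → ∀ i → liftS σ i ≡ liftS σ' i
liftS-cong e zero = refl
liftS-cong e (suc i) = cong wk (e i)

mutual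
  sub-cong : ∀ {m n} {σ σ' : Sub m n} → (∀ i → σ i ≡ σ' i) → ∀ t → sub σ t ≡ sub σ' t
  sub-cong e (var i) = e i
  sub-cong e (lam t) = cong lam (sub-cong (liftS-cong e) t)
  sub-cong e (app t u l) = cong₃ app (sub-cong e t) (sub-cong e u) (subC-cong e l)

  subC-cong : ∀ {m n} {σ σ' : Sub m n} → (∀ i → σ i ≡ σ' i) → ∀ l → subC σ l ≡ subC σ' l
  subC-cong e (u ∷ l) = cong₂ _∷_ (sub-cong e u) (subC-cong e l)
  subC-cong e (abs v) = cong abs (sub-cong (liftS-cong e) v)

liftS-liftR : ∀ {k m n} (σ : Sub m n) (ρ : Ren k m) i → liftS σ (liftR ρ i) ≡ liftS (σ ∘ ρ) i
liftS-liftR σ ρ zero = refl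
liftS-liftR σ ρ (suc i) = refl

mutual
  sub-ren : ∀ {k m n} (σ : Sub m n) (ρ : Ren k m) t → sub σ (ren ρ t) ≡ sub (σ ∘ ρ) t
  sub-ren σ ρ (var i) = refl
  sub-ren σ ρ (lam t) = cong lam (trans (sub-ren (liftS σ) (liftR ρ) t) (sub-cong (liftS-liftR σ ρ) t))
  sub-ren σ ρ (app t u l) = cong₃ app (sub-ren σ ρ t) (sub-ren σ ρ u) (subC-renC σ ρ l)

  subC-renC : ∀ {k m n} (σ : Sub m n) (ρ : Ren k m) l → subC σ (renC ρ l) ≡ subC (σ ∘ ρ) l
  subC-renC σ ρ (u ∷ l) = cong₂ _∷_ (sub-ren σ ρ u) (subC-renC σ ρ l)
  subC-renC σ ρ (abs v) = cong abs (trans (sub-ren (liftS σ) (liftR ρ) v) (sub-cong (liftS-liftR σ ρ) v))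

liftR-liftS : ∀ {k m n} (ρ : Ren m n) (σ : Sub k m) i → ren (liftR ρ) (liftS σ i) ≡ liftS (ren ρ ∘ σ) i
liftR-liftS ρ σ zero = refl
liftR-liftS ρ σ (suc i) = ren-wk ρ (σ i)

mutual
  ren-sub : ∀ {k m n} (ρ : Ren m n) (σ : Sub k m) t → ren ρ (sub σ t) ≡ sub (ren ρ ∘ σ) t
  ren-sub ρ σ (var i) = refl
  ren-sub ρ σ (lam t) = cong lam (trans (ren-sub (liftR ρ) (liftS σ) t) (sub-cong (liftR-liftS ρ σ) t))
  ren-sub ρ σ (app t u l) = cong₃ app (ren-sub ρ σ t) (ren-sub ρ σ u) (renC-subC ρ σ l)

  renC-subC : ∀ {k m n} (ρ : Ren m n) (σ : Sub k m) l → renC ρ (subC σ l) ≡ subC (ren ρ ∘ σ) l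
  renC-subC ρ σ (u ∷ l) = cong₂ _∷_ (ren-sub ρ σ u) (renC-subC ρ σ l)
  renC-subC ρ σ (abs v) = cong abs (trans (ren-sub (liftR ρ) (liftS σ) v) (sub-cong (liftR-liftS ρ σ) v))

sub-wk : ∀ {m n} (σ : Sub m n) t → sub (liftS σ) (wk t) ≡ wk (sub σ t)
sub-wk σ t = trans (sub-ren (liftS σ) suc t) (sym (ren-sub suc σ t))

subC-wkC : ∀ {m n} (σ : Sub m n) l → subC (liftS σ) (wkC l) ≡ wkC (subC σ l)
subC-wkC σ l = trans (subC-renC (liftS σ) suc l) (sym (renC-subC suc σ l))

liftS-∘ : ∀ {k m n} (τ : Sub m n) (σ : Sub k m) i → sub (liftS τ) (liftS σ i) ≡ liftS (sub τ ∘ σ) i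
liftS-∘ τ σ zero = refl
liftS-∘ τ σ (suc i) = sub-wk τ (σ i)

mutual
  sub-∘ : ∀ {k m n} (τ : Sub m n) (σ : Sub k m) t → sub τ (sub σ t) ≡ sub (sub τ ∘ σ) t
  sub-∘ τ σ (var i) = refl
  sub-∘ τ σ (lam t) = cong lam (trans (sub-∘ (liftS τ) (liftS σ) t) (sub-cong (liftS-∘ τ σ) t))
  sub-∘ τ σ (app t u l) = cong₃ app (sub-∘ τ σ t) (sub-∘ τ σ u) (subC-∘ τ σ l)

  subC-∘ : ∀ {k m n} (τ : Sub m n) (σ : Sub k m) l → subC τ (subC σ l) ≡ subC (sub τ ∘ σ) l
  subC-∘ τ σ (u ∷ l) = cong₂ _∷_ (sub-∘ τ σ u) (subC-∘ τ σ l)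
  subC-∘ τ σ (abs v) = cong abs (trans (sub-∘ (liftS τ) (liftS σ) v) (sub-cong (liftS-∘ τ σ) v))

liftS-var : ∀ {n} (i : Fin (suc n)) → liftS var i ≡ var i
liftS-var zero = refl
liftS-var (suc i) = refl

mutual
  sub-var : ∀ {n} (t : Tm n) → sub var t ≡ t
  sub-var (var i) = refl
  sub-var (lam t) = cong lam (trans (sub-cong liftS-var t) (sub-var t))
  sub-var (app t u l) = cong₃ app (sub-var t) (sub-var u) (subC-var l)

  subC-var : ∀ {n} (l : CoTm n) → subC var l ≡ l
  subC-var (u ∷ l) = cong₂ _∷_ (sub-var u) (subC-var l)
  subC-var (abs v) = cong abs (trans (sub-cong liftS-var v) (sub-var v))

wk-[] : ∀ {n} (t u : Tm n) → wk t [ u ] ≡ t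
wk-[] t u = trans (sub-ren (single u) suc t) (sub-var t)

wkC-[] : ∀ {n} (l : CoTm n) (u : Tm n) → subC (single u) (wkC l) ≡ l
wkC-[] l u = trans (subC-renC (single u) suc l) (subC-var l)

sub-[] : ∀ {m n} (σ : Sub m n) (t : Tm (suc m)) u →
         sub σ (t [ u ]) ≡ sub (liftS σ) t [ sub σ u ]
sub-[] σ t u = trans (sub-∘ σ (single u) t)
                (trans (sub-cong pointwise t) (sym (sub-∘ (single (sub σ u)) (liftS σ) t)))
  where
  pointwise : ∀ i → sub σ (single u i) ≡ sub (single (sub σ u)) (liftS σ i)
  pointwise zero = refl
  pointwise (suc i) = sym (wk-[] (σ i) (sub σ u))

ren-[] : ∀ {m n} (ρ : Ren m n) (t : Tm (suc m)) u →
         ren ρ (t [ u ]) ≡ ren (liftR ρ) t [ ren ρ u ]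
ren-[] ρ t u = trans (ren-sub ρ (single u) t)
                (trans (sub-cong pointwise t) (sym (sub-ren (single (ren ρ u)) (liftR ρ) t)))
  where
  pointwise : ∀ i → ren ρ (single u i) ≡ single (ren ρ u) (liftR ρ i)
  pointwise zero = refl
  pointwise (suc i) = refl

-- πμ-reduction

appπ : ∀ {n} → Tm n → Tm n → CoTm n → Tm n
appπ (var i) u l = app (var i) u l
appπ (lam t) u l = app (lam t) u l
appπ (app t u' l') u l = app t u' (l' ⊕ (u , l))

abs-⊕ : ∀ {n} (v : Tm (suc n)) u l → abs v ⊕ (u , l) ≡ abs (appπ v (wk u) (wkC l))
abs-⊕ (var i) u l = refl
abs-⊕ (lam v) u l = refl
abs-⊕ (app v u' l') u l = refl

mutual
  ren-appπ : ∀ {m n} (ρ : Ren m n) v u l → ren ρ (appπ v u l) ≡ appπ (ren ρ v) (ren ρ u) (renC ρ l)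
  ren-appπ ρ (var i) u l = refl
  ren-appπ ρ (lam v) u l = refl
  ren-appπ ρ (app t u' l') u l = cong (app _ _) (renC-⊕ ρ l' u l)

  renC-⊕ : ∀ {m n} (ρ : Ren m n) k u l → renC ρ (k ⊕ (u , l)) ≡ renC ρ k ⊕ (ren ρ u , renC ρ l)
  renC-⊕ ρ (w ∷ k) u l = cong (_ ∷_) (renC-⊕ ρ k u l)
  renC-⊕ ρ (abs v) u l = begin
    renC ρ (abs v ⊕ (u , l))                                    ≡⟨ cong (renC ρ) (abs-⊕ v u l) ⟩
    abs (ren (liftR ρ) (appπ v (wk u) (wkC l)))                 ≡⟨ cong abs (ren-appπ (liftR ρ) v (wk u) (wkC l)) ⟩
    abs (appπ (ren (liftR ρ) v) (ren (liftR ρ) (wk u)) (renC (liftR ρ) (wkC l)))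
      ≡⟨ cong₂ (λ a b → abs (appπ (ren (liftR ρ) v) a b)) (ren-wk ρ u) (renC-wkC ρ l) ⟩
    abs (appπ (ren (liftR ρ) v) (wk (ren ρ u)) (wkC (renC ρ l))) ≡⟨ sym (abs-⊕ (ren (liftR ρ) v) (ren ρ u) (renC ρ l)) ⟩
    abs (ren (liftR ρ) v) ⊕ (ren ρ u , renC ρ l)                ∎

infix 4 _⟶πμ_ _⟶πμC_ _⟶πμ*_ _⟶πμC*_

mutual
  data _⟶πμ_ {n : ℕ} : Tm n → Tm n → Set where
    π : ∀ {t u l u' l'} → app (app t u l) u' l' ⟶πμ app t u (l ⊕ (u' , l'))
    ξ-lam  : ∀ {t t'} → t ⟶πμ t' → lam t ⟶πμ lam t'
    ξ-app₁ : ∀ {t t' u l} → t ⟶πμ t' → app t u l ⟶πμ app t' u l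
    ξ-app₂ : ∀ {t u u' l} → u ⟶πμ u' → app t u l ⟶πμ app t u' l
    ξ-app₃ : ∀ {t u l l'} → l ⟶πμC l' → app t u l ⟶πμ app t u l'

  data _⟶πμC_ {n : ℕ} : CoTm n → CoTm n → Set where
    μ : ∀ {u l} → abs (app (var zero) (wk u) (wkC l)) ⟶πμC (u ∷ l)
    ξ-∷₁  : ∀ {u u' l} → u ⟶πμ u' → (u ∷ l) ⟶πμC (u' ∷ l)
    ξ-∷₂  : ∀ {u l l'} → l ⟶πμC l' → (u ∷ l) ⟶πμC (u ∷ l')
    ξ-abs : ∀ {v v'} → v ⟶πμ v' → abs v ⟶πμC abs v'

_⟶πμ*_ : ∀ {n} → Tm n → Tm n → Set
_⟶πμ*_ = Star _⟶πμ_

_⟶πμC*_ : ∀ {n} → CoTm n → CoTm n → Set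
_⟶πμC*_ = Star _⟶πμC_

lam-πμ* : ∀ {n} {t t' : Tm (suc n)} → t ⟶πμ* t' → lam t ⟶πμ* lam t'
lam-πμ* = gmap lam ξ-lam

app-πμ* : ∀ {n} {t t' u u' : Tm n} {l l'} → t ⟶πμ* t' → u ⟶πμ* u' → l ⟶πμC* l' → app t u l ⟶πμ* app t' u' l'
app-πμ* {t' = t'} {u} {u'} {l} a b c =
  gmap (λ x → app x u l) ξ-app₁ a ◅◅ gmap (λ x → app t' x l) ξ-app₂ b ◅◅ gmap (app t' u') ξ-app₃ c

∷-πμ* : ∀ {n} {u u' : Tm n} {l l'} → u ⟶πμ* u' → l ⟶πμC* l' → (u ∷ l) ⟶πμC* (u' ∷ l')
∷-πμ* {u' = u'} {l} a b = gmap (_∷ l) ξ-∷₁ a ◅◅ gmap (u' ∷_) ξ-∷₂ b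

abs-πμ* : ∀ {n} {v v' : Tm (suc n)} → v ⟶πμ* v' → abs v ⟶πμC* abs v'
abs-πμ* = gmap abs ξ-abs

mutual
  ren-πμ : ∀ {m n} (ρ : Ren m n) {t t'} → t ⟶πμ t' → ren ρ t ⟶πμ ren ρ t'
  ren-πμ ρ (π {l = l} {u'} {l'}) rewrite renC-⊕ ρ l u' l' = π
  ren-πμ ρ (ξ-lam r) = ξ-lam (ren-πμ (liftR ρ) r)
  ren-πμ ρ (ξ-app₁ r) = ξ-app₁ (ren-πμ ρ r)
  ren-πμ ρ (ξ-app₂ r) = ξ-app₂ (ren-πμ ρ r)
  ren-πμ ρ (ξ-app₃ r) = ξ-app₃ (renC-πμ ρ r)

  renC-πμ : ∀ {m n} (ρ : Ren m n) {l l'} → l ⟶πμC l' → renC ρ l ⟶πμC renC ρ l'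
  renC-πμ ρ (μ {u} {l}) rewrite ren-wk ρ u | renC-wkC ρ l = μ
  renC-πμ ρ (ξ-∷₁ r) = ξ-∷₁ (ren-πμ ρ r)
  renC-πμ ρ (ξ-∷₂ r) = ξ-∷₂ (renC-πμ ρ r)
  renC-πμ ρ (ξ-abs r) = ξ-abs (ren-πμ (liftR ρ) r)

app⟶πμ*appπ : ∀ {n} (t u : Tm n) l → app t u l ⟶πμ* appπ t u l
app⟶πμ*appπ (var i) u l = ε
app⟶πμ*appπ (lam t) u l = ε
app⟶πμ*appπ (app t u' l') u l = return π

mutual
  sub-appπ : ∀ {m n} (σ : Sub m n) v u l → sub σ (appπ v u l) ⟶πμ* appπ (sub σ v) (sub σ u) (subC σ l)
  sub-appπ σ (var i) u l = app⟶πμ*appπ (σ i) (sub σ u) (subC σ l)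
  sub-appπ σ (lam v) u l = ε
  sub-appπ σ (app t u' l') u l = app-πμ* ε ε (subC-⊕ σ l' u l)

  subC-⊕ : ∀ {m n} (σ : Sub m n) k u l → subC σ (k ⊕ (u , l)) ⟶πμC* subC σ k ⊕ (sub σ u , subC σ l)
  subC-⊕ σ (w ∷ k) u l = ∷-πμ* ε (subC-⊕ σ k u l)
  subC-⊕ σ (abs v) u l
    rewrite abs-⊕ v u l | abs-⊕ (sub (liftS σ) v) (sub σ u) (subC σ l)
          | sym (sub-wk σ u) | sym (subC-wkC σ l)
    = abs-πμ* (sub-appπ (liftS σ) v (wk u) (wkC l))

ren-πμ* : ∀ {m n} (ρ : Ren m n) {t t'} → t ⟶πμ* t' → ren ρ t ⟶πμ* ren ρ t'
ren-πμ* ρ = gmap (ren ρ) (ren-πμ ρ)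

Joinable : ∀ {A : Set} → (A → A → Set) → A → A → Set
Joinable R a b = ∃ λ c → Star R a c × Star R b c

mutual
  sub-πμ : ∀ {m n} (σ : Sub m n) {t t'} → t ⟶πμ t' → Joinable _⟶πμ_ (sub σ t) (sub σ t')
  sub-πμ σ (π {l = l} {u'} {l'}) = _ , return π , app-πμ* ε ε (subC-⊕ σ l u' l')
  sub-πμ σ (ξ-lam r) with sub-πμ (liftS σ) r
  ... | _ , a , b = _ , lam-πμ* a , lam-πμ* b
  sub-πμ σ (ξ-app₁ r) with sub-πμ σ r
  ... | _ , a , b = _ , app-πμ* a ε ε , app-πμ* b ε ε
  sub-πμ σ (ξ-app₂ r) with sub-πμ σ r
  ... | _ , a , b = _ , app-πμ* ε a ε , app-πμ* ε b ε
  sub-πμ σ (ξ-app₃ r) with subC-πμ σ r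
  ... | _ , a , b = _ , app-πμ* ε ε a , app-πμ* ε ε b

  subC-πμ : ∀ {m n} (σ : Sub m n) {l l'} → l ⟶πμC l' → Joinable _⟶πμC_ (subC σ l) (subC σ l')
  subC-πμ σ (μ {u} {l}) rewrite sub-wk σ u | subC-wkC σ l = _ , return μ , ε
  subC-πμ σ (ξ-∷₁ r) with sub-πμ σ r
  ... | _ , a , b = _ , ∷-πμ* a ε , ∷-πμ* b ε
  subC-πμ σ (ξ-∷₂ r) with subC-πμ σ r
  ... | _ , a , b = _ , ∷-πμ* ε a , ∷-πμ* ε b
  subC-πμ σ (ξ-abs r) with sub-πμ (liftS σ) r
  ... | _ , a , b = _ , abs-πμ* a , abs-πμ* b

liftS-πμ* : ∀ {m n} {σ σ' : Sub m n} → (∀ i → σ i ⟶πμ* σ' i) → ∀ i → liftS σ i ⟶πμ* liftS σ' i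
liftS-πμ* r zero = ε
liftS-πμ* r (suc i) = ren-πμ* suc (r i)

mutual
  sub-cong-πμ* : ∀ {m n} {σ σ' : Sub m n} → (∀ i → σ i ⟶πμ* σ' i) → ∀ t → sub σ t ⟶πμ* sub σ' t
  sub-cong-πμ* r (var i) = r i
  sub-cong-πμ* r (lam t) = lam-πμ* (sub-cong-πμ* (liftS-πμ* r) t)
  sub-cong-πμ* r (app t u l) = app-πμ* (sub-cong-πμ* r t) (sub-cong-πμ* r u) (subC-cong-πμ* r l)

  subC-cong-πμ* : ∀ {m n} {σ σ' : Sub m n} → (∀ i → σ i ⟶πμ* σ' i) → ∀ l → subC σ l ⟶πμC* subC σ' l
  subC-cong-πμ* r (u ∷ l) = ∷-πμ* (sub-cong-πμ* r u) (subC-cong-πμ* r l)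
  subC-cong-πμ* r (abs v) = abs-πμ* (sub-cong-πμ* (liftS-πμ* r) v)

PartialRen : ℕ → ℕ → Set
PartialRen m n = Fin m → Maybe (Fin n)

liftP : ∀ {m n} → PartialRen m n → PartialRen (suc m) (suc n)
liftP φ zero = just zero
liftP φ (suc i) = mapᴹ suc (φ i)

mutual
  strengthen : ∀ {m n} → PartialRen m n → Tm m → Maybe (Tm n)
  strengthen φ (var i) = mapᴹ var (φ i)
  strengthen φ (lam t) = mapᴹ lam (strengthen (liftP φ) t)
  strengthen φ (app t u l) = zipWith (uncurry app) (zip (strengthen φ t) (strengthen φ u)) (strengthenC φ l)

  strengthenC : ∀ {m n} → PartialRen m n → CoTm m → Maybe (CoTm n)
  strengthenC φ (u ∷ l) = zipWith _∷_ (strengthen φ u) (strengthenC φ l)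
  strengthenC φ (abs v) = mapᴹ abs (strengthen (liftP φ) v)

drop0 : ∀ {n} → PartialRen (suc n) n
drop0 zero = nothing
drop0 (suc i) = just i

liftP-just : ∀ {k m n} {φ : PartialRen m n} {ρ : Ren k m} {ρ' : Ren k n} →
  (∀ i → φ (ρ i) ≡ just (ρ' i)) → ∀ i → liftP φ (liftR ρ i) ≡ just (liftR ρ' i)
liftP-just e zero = refl
liftP-just e (suc i) rewrite e i = refl

mutual
  strengthen-ren-just : ∀ {k m n} {φ : PartialRen m n} {ρ : Ren k m} {ρ' : Ren k n} →
    (∀ i → φ (ρ i) ≡ just (ρ' i)) → ∀ t → strengthen φ (ren ρ t) ≡ just (ren ρ' t)
  strengthen-ren-just e (var i) rewrite e i = refl
  strengthen-ren-just {φ = φ} {ρ} {ρ'} e (lam t) =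
    cong (mapᴹ lam) (strengthen-ren-just {φ = liftP φ} {liftR ρ} {liftR ρ'} (liftP-just e) t)
  strengthen-ren-just e (app t u l) =
    cong₃ (λ a b c → zipWith (uncurry app) (zip a b) c) (strengthen-ren-just e t) (strengthen-ren-just e u) (strengthenC-renC-just e l)

  strengthenC-renC-just : ∀ {k m n} {φ : PartialRen m n} {ρ : Ren k m} {ρ' : Ren k n} →
    (∀ i → φ (ρ i) ≡ just (ρ' i)) → ∀ l → strengthenC φ (renC ρ l) ≡ just (renC ρ' l)
  strengthenC-renC-just e (u ∷ l) = cong₂ (zipWith _∷_) (strengthen-ren-just e u) (strengthenC-renC-just e l)
  strengthenC-renC-just {φ = φ} {ρ} {ρ'} e (abs v) =
    cong (mapᴹ abs) (strengthen-ren-just {φ = liftP φ} {liftR ρ} {liftR ρ'} (liftP-just e) v)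

strengthen-wk : ∀ {n} (t : Tm n) → strengthen drop0 (wk t) ≡ just t
strengthen-wk t = trans (strengthen-ren-just {ρ' = id} (λ _ → refl) t) (cong just (ren-id t))

strengthenC-wkC : ∀ {n} (l : CoTm n) → strengthenC drop0 (wkC l) ≡ just l
strengthenC-wkC l = trans (strengthenC-renC-just {ρ' = id} (λ _ → refl) l) (cong just (renC-id l))

liftP-sound : ∀ {m n} {φ : PartialRen m n} {ρ : Ren n m} →
  (∀ i j → φ i ≡ just j → i ≡ ρ j) → ∀ i j → liftP φ i ≡ just j → i ≡ liftR ρ j
liftP-sound e zero .zero refl = refl
liftP-sound {φ = φ} e (suc i) j eq with φ i in eq'
liftP-sound {φ = φ} e (suc i) .(suc j') refl | just j' = cong suc (e i j' eq')

mutual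
  strengthen-sound : ∀ {m n} {φ : PartialRen m n} {ρ : Ren n m} →
    (∀ i j → φ i ≡ just j → i ≡ ρ j) → ∀ t {t'} → strengthen φ t ≡ just t' → t ≡ ren ρ t'
  strengthen-sound {φ = φ} e (var i) eq with φ i in eq'
  strengthen-sound {φ = φ} e (var i) refl | just j = cong var (e i j eq')
  strengthen-sound {φ = φ} e (lam t) eq with strengthen (liftP φ) t in eq'
  strengthen-sound {φ = φ} e (lam t) refl | just t' = cong lam (strengthen-sound (liftP-sound e) t eq')
  strengthen-sound {φ = φ} e (app t u l) eq
    with strengthen φ t in e₁ | strengthen φ u in e₂ | strengthenC φ l in e₃
  strengthen-sound {φ = φ} e (app t u l) refl | just _ | just _ | just _ =
    cong₃ app (strengthen-sound e t e₁) (strengthen-sound e u e₂) (strengthenC-sound e l e₃)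

  strengthenC-sound : ∀ {m n} {φ : PartialRen m n} {ρ : Ren n m} →
    (∀ i j → φ i ≡ just j → i ≡ ρ j) → ∀ l {l'} → strengthenC φ l ≡ just l' → l ≡ renC ρ l'
  strengthenC-sound {φ = φ} e (u ∷ l) eq with strengthen φ u in e₁ | strengthenC φ l in e₂
  strengthenC-sound {φ = φ} e (u ∷ l) refl | just _ | just _ =
    cong₂ _∷_ (strengthen-sound e u e₁) (strengthenC-sound e l e₂)
  strengthenC-sound {φ = φ} e (abs v) eq with strengthen (liftP φ) v in eq'
  strengthenC-sound {φ = φ} e (abs v) refl | just v' = cong abs (strengthen-sound (liftP-sound e) v eq')

drop0-sound : ∀ {n} (i : Fin (suc n)) j → drop0 i ≡ just j → i ≡ suc j
drop0-sound (suc i) .i refl = refl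

map-square : ∀ {A B C D : Set} {f : B → D} {g : A → B} {h : C → D} {k : A → C} →
  (∀ x → f (g x) ≡ h (k x)) → ∀ mx → mapᴹ f (mapᴹ g mx) ≡ mapᴹ h (mapᴹ k mx)
map-square e (just x) = cong just (e x)
map-square e nothing = refl

zipWith-map : ∀ {A A' B B' C C' : Set} {f : A → B → C} {f' : A' → B' → C'}
  {g : A → A'} {h : B → B'} {k : C → C'} → (∀ x y → f' (g x) (h y) ≡ k (f x y)) →
  ∀ ma mb → zipWith f' (mapᴹ g ma) (mapᴹ h mb) ≡ mapᴹ k (zipWith f ma mb)
zipWith-map e (just x) (just y) = cong just (e x y)
zipWith-map e (just x) nothing = refl
zipWith-map e nothing mb = refl

liftP-ren : ∀ {k m n j} {φ : PartialRen m n} {φ' : PartialRen k j} {ρ : Ren k m} {ρ' : Ren j n} →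
  (∀ i → φ (ρ i) ≡ mapᴹ ρ' (φ' i)) → ∀ i → liftP φ (liftR ρ i) ≡ mapᴹ (liftR ρ') (liftP φ' i)
liftP-ren e zero = refl
liftP-ren {φ' = φ'} e (suc i) rewrite e i = map-square (λ _ → refl) (φ' i)

mutual
  strengthen-ren : ∀ {k m n j} {φ : PartialRen m n} {φ' : PartialRen k j} {ρ : Ren k m} {ρ' : Ren j n} →
    (∀ i → φ (ρ i) ≡ mapᴹ ρ' (φ' i)) → ∀ t → strengthen φ (ren ρ t) ≡ mapᴹ (ren ρ') (strengthen φ' t)
  strengthen-ren {φ' = φ'} e (var i) rewrite e i = map-square (λ _ → refl) (φ' i)
  strengthen-ren {φ = φ} {φ'} {ρ} {ρ'} e (lam t) =
    trans (cong (mapᴹ lam) (strengthen-ren {φ = liftP φ} {liftP φ'} {liftR ρ} {liftR ρ'} (liftP-ren e) t))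
          (map-square (λ _ → refl) (strengthen (liftP φ') t))
  strengthen-ren {φ' = φ'} e (app t u l) = begin
    zipWith (uncurry app) (zip (strengthen _ (ren _ t)) (strengthen _ (ren _ u))) (strengthenC _ (renC _ l))
      ≡⟨ cong₃ (λ a b c → zipWith (uncurry app) (zip a b) c)
               (strengthen-ren e t) (strengthen-ren e u) (strengthenC-renC e l) ⟩
    zipWith (uncurry app) (zip (mapᴹ (ren _) (strengthen φ' t)) (mapᴹ (ren _) (strengthen φ' u)))
                          (mapᴹ (renC _) (strengthenC φ' l))
      ≡⟨ cong (λ a → zipWith (uncurry app) a _) (zipWith-map (λ _ _ → refl) (strengthen φ' t) (strengthen φ' u)) ⟩
    zipWith (uncurry app) (mapᴹ (map (ren _) (ren _)) (zip (strengthen φ' t) (strengthen φ' u))) (mapᴹ (renC _) (strengthenC φ' l))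
      ≡⟨ zipWith-map (λ _ _ → refl) (zip (strengthen φ' t) (strengthen φ' u)) (strengthenC φ' l) ⟩
    mapᴹ (ren _) (zipWith (uncurry app) (zip (strengthen φ' t) (strengthen φ' u)) (strengthenC φ' l)) ∎

  strengthenC-renC : ∀ {k m n j} {φ : PartialRen m n} {φ' : PartialRen k j} {ρ : Ren k m} {ρ' : Ren j n} →
    (∀ i → φ (ρ i) ≡ mapᴹ ρ' (φ' i)) → ∀ l → strengthenC φ (renC ρ l) ≡ mapᴹ (renC ρ') (strengthenC φ' l)
  strengthenC-renC {φ' = φ'} e (u ∷ l) =
    trans (cong₂ (zipWith _∷_) (strengthen-ren e u) (strengthenC-renC e l))
          (zipWith-map (λ _ _ → refl) (strengthen φ' u) (strengthenC φ' l))
  strengthenC-renC {φ = φ} {φ'} {ρ} {ρ'} e (abs v) =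
    trans (cong (mapᴹ abs) (strengthen-ren {φ = liftP φ} {liftP φ'} {liftR ρ} {liftR ρ'} (liftP-ren e) v))
          (map-square (λ _ → refl) (strengthen (liftP φ') v))

drop0-liftR : ∀ {m n} (ρ : Ren m n) i → drop0 (liftR ρ i) ≡ mapᴹ ρ (drop0 i)
drop0-liftR ρ zero = refl
drop0-liftR ρ (suc i) = refl

-- abs w is a μ-redex iff w = x(u,l) with x ∉ u, l, decided by strengthening u and l.
μredex : ∀ {n} → Tm (suc n) → Maybe (Tm n × CoTm n)
μredex (app (var zero) u l) = zip (strengthen drop0 u) (strengthenC drop0 l)
μredex (app (var (suc i)) u l) = nothing
μredex (app (lam t) u l) = nothing
μredex (app (app t u' l') u l) = nothing
μredex (var i) = nothing
μredex (lam t) = nothing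

contractμ : ∀ {n} → Tm (suc n) → Maybe (Tm n × CoTm n) → CoTm n
contractμ w nothing = abs w
contractμ w (just (u , l)) = u ∷ l

absμ : ∀ {n} → Tm (suc n) → CoTm n
absμ w = contractμ w (μredex w)

μredex-sound : ∀ {n} (w : Tm (suc n)) {u l} → μredex w ≡ just (u , l) → w ≡ app (var zero) (wk u) (wkC l)
μredex-sound (app (var zero) u l) eq with strengthen drop0 u in e₁ | strengthenC drop0 l in e₂
μredex-sound (app (var zero) u l) refl | just _ | just _ =
  cong₂ (app (var zero)) (strengthen-sound drop0-sound u e₁) (strengthenC-sound drop0-sound l e₂)

absμ-μredex : ∀ {n} (u : Tm n) l → absμ (app (var zero) (wk u) (wkC l)) ≡ u ∷ l
absμ-μredex u l rewrite strengthen-wk u | strengthenC-wkC l = refl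

μredex-ren : ∀ {m n} (ρ : Ren m n) w → μredex (ren (liftR ρ) w) ≡ mapᴹ (map (ren ρ) (renC ρ)) (μredex w)
μredex-ren ρ (app (var zero) u l) =
  trans (cong₂ zip (strengthen-ren {φ' = drop0} (drop0-liftR ρ) u) (strengthenC-renC {φ' = drop0} (drop0-liftR ρ) l))
        (zipWith-map (λ _ _ → refl) (strengthen drop0 u) (strengthenC drop0 l))
μredex-ren ρ (app (var (suc i)) u l) = refl
μredex-ren ρ (app (lam t) u l) = refl
μredex-ren ρ (app (app t u' l') u l) = refl
μredex-ren ρ (var i) = refl
μredex-ren ρ (lam t) = refl

renC-absμ : ∀ {m n} (ρ : Ren m n) w → renC ρ (absμ w) ≡ absμ (ren (liftR ρ) w)
renC-absμ ρ w rewrite μredex-ren ρ w with μredex w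
... | nothing = refl
... | just _ = refl

abs⟶πμ*absμ : ∀ {n} (w : Tm (suc n)) → abs w ⟶πμC* absμ w
abs⟶πμ*absμ w with μredex w in eq
... | nothing = ε
... | just (u , l) rewrite μredex-sound w eq = return μ

-- πμ-normal forms

mutual
  appNF : ∀ {n} → Tm n → Tm n → CoTm n → Tm n
  appNF (var i) u l = app (var i) u l
  appNF (lam t) u l = app (lam t) u l
  appNF (app t u' l') u l = app t u' (appendNF l' u l)

  appendNF : ∀ {n} → CoTm n → Tm n → CoTm n → CoTm n
  appendNF (w ∷ k) u l = w ∷ appendNF k u l
  appendNF (abs v) u l = absμ (appNF v (wk u) (wkC l))

mutual
  nf : ∀ {n} → Tm n → Tm n
  nf (var i) = var i
  nf (lam t) = lam (nf t)
  nf (app t u l) = appNF (nf t) (nf u) (nfC l)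

  nfC : ∀ {n} → CoTm n → CoTm n
  nfC (u ∷ l) = nf u ∷ nfC l
  nfC (abs v) = absμ (nf v)

mutual
  ren-appNF : ∀ {m n} (ρ : Ren m n) t u l → ren ρ (appNF t u l) ≡ appNF (ren ρ t) (ren ρ u) (renC ρ l)
  ren-appNF ρ (var i) u l = refl
  ren-appNF ρ (lam t) u l = refl
  ren-appNF ρ (app t u' l') u l = cong (app _ _) (renC-appendNF ρ l' u l)

  renC-appendNF : ∀ {m n} (ρ : Ren m n) k u l → renC ρ (appendNF k u l) ≡ appendNF (renC ρ k) (ren ρ u) (renC ρ l)
  renC-appendNF ρ (w ∷ k) u l = cong (_ ∷_) (renC-appendNF ρ k u l)
  renC-appendNF ρ (abs v) u l = begin
    renC ρ (absμ (appNF v (wk u) (wkC l)))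
      ≡⟨ renC-absμ ρ _ ⟩
    absμ (ren (liftR ρ) (appNF v (wk u) (wkC l)))
      ≡⟨ cong absμ (ren-appNF (liftR ρ) v (wk u) (wkC l)) ⟩
    absμ (appNF (ren (liftR ρ) v) (ren (liftR ρ) (wk u)) (renC (liftR ρ) (wkC l)))
      ≡⟨ cong₂ (λ a b → absμ (appNF (ren (liftR ρ) v) a b)) (ren-wk ρ u) (renC-wkC ρ l) ⟩
    absμ (appNF (ren (liftR ρ) v) (wk (ren ρ u)) (wkC (renC ρ l))) ∎

mutual
  nf-ren : ∀ {m n} (ρ : Ren m n) t → nf (ren ρ t) ≡ ren ρ (nf t)
  nf-ren ρ (var i) = refl
  nf-ren ρ (lam t) = cong lam (nf-ren (liftR ρ) t)
  nf-ren ρ (app t u l) =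
    trans (cong₃ appNF (nf-ren ρ t) (nf-ren ρ u) (nfC-renC ρ l)) (sym (ren-appNF ρ (nf t) (nf u) (nfC l)))

  nfC-renC : ∀ {m n} (ρ : Ren m n) l → nfC (renC ρ l) ≡ renC ρ (nfC l)
  nfC-renC ρ (u ∷ l) = cong₂ _∷_ (nf-ren ρ u) (nfC-renC ρ l)
  nfC-renC ρ (abs v) = trans (cong absμ (nf-ren (liftR ρ) v)) (sym (renC-absμ ρ (nf v)))

appendNF-absμ : ∀ {n} (w : Tm (suc n)) u l → appendNF (absμ w) u l ≡ absμ (appNF w (wk u) (wkC l))
appendNF-absμ w u l with μredex w in eq
... | nothing = refl
... | just (p , q) = begin
  p ∷ appendNF q u l                                           ≡⟨ sym (absμ-μredex p (appendNF q u l)) ⟩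
  absμ (app (var zero) (wk p) (wkC (appendNF q u l)))          ≡⟨ cong (absμ ∘ app (var zero) (wk p)) (renC-appendNF suc q u l) ⟩
  absμ (appNF (app (var zero) (wk p) (wkC q)) (wk u) (wkC l))  ≡⟨ cong (λ x → absμ (appNF x (wk u) (wkC l))) (sym (μredex-sound w eq)) ⟩
  absμ (appNF w (wk u) (wkC l))                                ∎

mutual
  appNF-assoc : ∀ {n} (t u : Tm n) l u' l' → appNF (appNF t u l) u' l' ≡ appNF t u (appendNF l u' l')
  appNF-assoc (var i) u l u' l' = refl
  appNF-assoc (lam t) u l u' l' = refl
  appNF-assoc (app t w k) u l u' l' = cong (app t w) (appendNF-assoc k u l u' l')

  appendNF-assoc : ∀ {n} (k : CoTm n) u l u' l' → appendNF (appendNF k u l) u' l' ≡ appendNF k u (appendNF l u' l')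
  appendNF-assoc (w ∷ k) u l u' l' = cong (w ∷_) (appendNF-assoc k u l u' l')
  appendNF-assoc (abs v) u l u' l' = begin
    appendNF (absμ (appNF v (wk u) (wkC l))) u' l'
      ≡⟨ appendNF-absμ _ u' l' ⟩
    absμ (appNF (appNF v (wk u) (wkC l)) (wk u') (wkC l'))
      ≡⟨ cong absμ (appNF-assoc v (wk u) (wkC l) (wk u') (wkC l')) ⟩
    absμ (appNF v (wk u) (appendNF (wkC l) (wk u') (wkC l')))
      ≡⟨ cong (absμ ∘ appNF v (wk u)) (sym (renC-appendNF suc l u' l')) ⟩
    absμ (appNF v (wk u) (wkC (appendNF l u' l'))) ∎

mutual
  nf-appπ : ∀ {n} (v u : Tm n) l → nf (appπ v u l) ≡ appNF (nf v) (nf u) (nfC l)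
  nf-appπ (var i) u l = refl
  nf-appπ (lam v) u l = refl
  nf-appπ (app t w k) u l = begin
    appNF (nf t) (nf w) (nfC (k ⊕ (u , l)))               ≡⟨ cong (appNF (nf t) (nf w)) (nfC-⊕ k u l) ⟩
    appNF (nf t) (nf w) (appendNF (nfC k) (nf u) (nfC l)) ≡⟨ sym (appNF-assoc (nf t) (nf w) (nfC k) (nf u) (nfC l)) ⟩
    appNF (appNF (nf t) (nf w) (nfC k)) (nf u) (nfC l)    ∎

  nfC-⊕ : ∀ {n} (k : CoTm n) u l → nfC (k ⊕ (u , l)) ≡ appendNF (nfC k) (nf u) (nfC l)
  nfC-⊕ (w ∷ k) u l = cong (nf w ∷_) (nfC-⊕ k u l)
  nfC-⊕ (abs v) u l = begin
    nfC (abs v ⊕ (u , l))                            ≡⟨ cong nfC (abs-⊕ v u l) ⟩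
    absμ (nf (appπ v (wk u) (wkC l)))                ≡⟨ cong absμ (nf-appπ v (wk u) (wkC l)) ⟩
    absμ (appNF (nf v) (nf (wk u)) (nfC (wkC l)))    ≡⟨ cong₂ (λ a b → absμ (appNF (nf v) a b)) (nf-ren suc u) (nfC-renC suc l) ⟩
    absμ (appNF (nf v) (wk (nf u)) (wkC (nfC l)))    ≡⟨ sym (appendNF-absμ (nf v) (nf u) (nfC l)) ⟩
    appendNF (absμ (nf v)) (nf u) (nfC l)            ∎

nfC-μredex : ∀ {n} (u : Tm n) l → nfC (abs (app (var zero) (wk u) (wkC l))) ≡ nf u ∷ nfC l
nfC-μredex u l = begin
  absμ (app (var zero) (nf (wk u)) (nfC (wkC l)))  ≡⟨ cong₂ (λ a b → absμ (app (var zero) a b)) (nf-ren suc u) (nfC-renC suc l) ⟩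
  absμ (app (var zero) (wk (nf u)) (wkC (nfC l)))  ≡⟨ absμ-μredex (nf u) (nfC l) ⟩
  nf u ∷ nfC l                                     ∎

mutual
  nf-πμ : ∀ {n} {t t' : Tm n} → t ⟶πμ t' → nf t ≡ nf t'
  nf-πμ (π {t} {u} {l} {u'} {l'}) = begin
    appNF (appNF (nf t) (nf u) (nfC l)) (nf u') (nfC l')  ≡⟨ appNF-assoc (nf t) (nf u) (nfC l) (nf u') (nfC l') ⟩
    appNF (nf t) (nf u) (appendNF (nfC l) (nf u') (nfC l'))  ≡⟨ cong (appNF (nf t) (nf u)) (sym (nfC-⊕ l u' l')) ⟩
    appNF (nf t) (nf u) (nfC (l ⊕ (u' , l')))             ∎
  nf-πμ (ξ-lam r) = cong lam (nf-πμ r)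
  nf-πμ (ξ-app₁ r) = cong (λ x → appNF x _ _) (nf-πμ r)
  nf-πμ (ξ-app₂ r) = cong (λ x → appNF _ x _) (nf-πμ r)
  nf-πμ (ξ-app₃ r) = cong (appNF _ _) (nfC-πμ r)

  nfC-πμ : ∀ {n} {l l' : CoTm n} → l ⟶πμC l' → nfC l ≡ nfC l'
  nfC-πμ (μ {u} {l}) = nfC-μredex u l
  nfC-πμ (ξ-∷₁ r) = cong (_∷ _) (nf-πμ r)
  nfC-πμ (ξ-∷₂ r) = cong (_ ∷_) (nfC-πμ r)
  nfC-πμ (ξ-abs r) = cong absμ (nf-πμ r)

nf-πμ* : ∀ {n} {t t' : Tm n} → t ⟶πμ* t' → nf t ≡ nf t'
nf-πμ* ε = refl
nf-πμ* (r ◅ rs) = trans (nf-πμ r) (nf-πμ* rs)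

mutual
  appπ⟶πμ*appNF : ∀ {n} (v u : Tm n) l → appπ v u l ⟶πμ* appNF v u l
  appπ⟶πμ*appNF (var i) u l = ε
  appπ⟶πμ*appNF (lam v) u l = ε
  appπ⟶πμ*appNF (app t w k) u l = app-πμ* ε ε (⊕⟶πμ*appendNF k u l)

  ⊕⟶πμ*appendNF : ∀ {n} (k : CoTm n) u l → k ⊕ (u , l) ⟶πμC* appendNF k u l
  ⊕⟶πμ*appendNF (w ∷ k) u l = ∷-πμ* ε (⊕⟶πμ*appendNF k u l)
  ⊕⟶πμ*appendNF (abs v) u l rewrite abs-⊕ v u l =
    abs-πμ* (appπ⟶πμ*appNF v (wk u) (wkC l)) ◅◅ abs⟶πμ*absμ _

mutual
  ⟶πμ*nf : ∀ {n} (t : Tm n) → t ⟶πμ* nf t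
  ⟶πμ*nf (var i) = ε
  ⟶πμ*nf (lam t) = lam-πμ* (⟶πμ*nf t)
  ⟶πμ*nf (app t u l) =
    app-πμ* (⟶πμ*nf t) (⟶πμ*nf u) (⟶πμC*nfC l)
    ◅◅ app⟶πμ*appπ (nf t) (nf u) (nfC l) ◅◅ appπ⟶πμ*appNF (nf t) (nf u) (nfC l)

  ⟶πμC*nfC : ∀ {n} (l : CoTm n) → l ⟶πμC* nfC l
  ⟶πμC*nfC (u ∷ l) = ∷-πμ* (⟶πμ*nf u) (⟶πμC*nfC l)
  ⟶πμC*nfC (abs v) = abs-πμ* (⟶πμ*nf v) ◅◅ abs⟶πμ*absμ (nf v)

nf-sub-πμ* : ∀ {m n} (σ : Sub m n) {t t'} → t ⟶πμ* t' → nf (sub σ t) ≡ nf (sub σ t')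
nf-sub-πμ* σ ε = refl
nf-sub-πμ* σ (r ◅ rs) with sub-πμ σ r
... | _ , a , b = trans (trans (nf-πμ* a) (sym (nf-πμ* b))) (nf-sub-πμ* σ rs)

-- nf ∘ sub σ depends only on nf t and nf ∘ σ, since both normalise to nf (sub (nf ∘ σ) (nf t)).
nf-sub-cong : ∀ {m n} {σ σ' : Sub m n} {t t' : Tm m} → nf t ≡ nf t' → (∀ i → nf (σ i) ≡ nf (σ' i)) →
              nf (sub σ t) ≡ nf (sub σ' t')
nf-sub-cong {σ = σ} {σ'} {t} {t'} e es = begin
  nf (sub σ t)                  ≡⟨ nf-sub-πμ* σ (⟶πμ*nf t) ⟩
  nf (sub σ (nf t))             ≡⟨ nf-πμ* (sub-cong-πμ* (⟶πμ*nf ∘ σ) (nf t)) ⟩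
  nf (sub (nf ∘ σ) (nf t))      ≡⟨ cong nf (trans (cong (sub (nf ∘ σ)) e) (sub-cong es (nf t'))) ⟩
  nf (sub (nf ∘ σ') (nf t'))    ≡⟨ sym (nf-πμ* (sub-cong-πμ* (⟶πμ*nf ∘ σ') (nf t'))) ⟩
  nf (sub σ' (nf t'))           ≡⟨ sym (nf-sub-πμ* σ' (⟶πμ*nf t')) ⟩
  nf (sub σ' t')                ∎

nf-[]-cong : ∀ {n} {t t' : Tm (suc n)} {u u' : Tm n} → nf t ≡ nf t' → nf u ≡ nf u' → nf (t [ u ]) ≡ nf (t' [ u' ])
nf-[]-cong {t = t} {t'} {u} {u'} e e' = nf-sub-cong {σ = single u} {single u'} {t} {t'} e λ { zero → e' ; (suc i) → refl }

-- Parallel β-reduction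

infix 4 _⇉_ _⇉C_

mutual
  data _⇉_ {n : ℕ} : Tm n → Tm n → Set where
    pvar : ∀ {i} → var i ⇉ var i
    plam : ∀ {t t'} → t ⇉ t' → lam t ⇉ lam t'
    papp : ∀ {t t' u u' l l'} → t ⇉ t' → u ⇉ u' → l ⇉C l' → app t u l ⇉ app t' u' l'
    pβ₁ : ∀ {t t' u u' v v'} → t ⇉ t' → u ⇉ u' → v ⇉ v' → app (lam t) u (abs v) ⇉ v' [ t' [ u' ] ]
    pβ₂ : ∀ {t t' u u' w w' l l'} → t ⇉ t' → u ⇉ u' → w ⇉ w' → l ⇉C l' →
          app (lam t) u (w ∷ l) ⇉ app (t' [ u' ]) w' l'

  data _⇉C_ {n : ℕ} : CoTm n → CoTm n → Set where
    p∷ : ∀ {u u' l l'} → u ⇉ u' → l ⇉C l' → (u ∷ l) ⇉C (u' ∷ l')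
    pabs : ∀ {v v'} → v ⇉ v' → abs v ⇉C abs v'

mutual
  ⇉-refl : ∀ {n} (t : Tm n) → t ⇉ t
  ⇉-refl (var i) = pvar
  ⇉-refl (lam t) = plam (⇉-refl t)
  ⇉-refl (app t u l) = papp (⇉-refl t) (⇉-refl u) (⇉C-refl l)

  ⇉C-refl : ∀ {n} (l : CoTm n) → l ⇉C l
  ⇉C-refl (u ∷ l) = p∷ (⇉-refl u) (⇉C-refl l)
  ⇉C-refl (abs v) = pabs (⇉-refl v)

ren-[[]] : ∀ {m n} (ρ : Ren m n) v t u → ren ρ (v [ t [ u ] ]) ≡ ren (liftR ρ) v [ ren (liftR ρ) t [ ren ρ u ] ]
ren-[[]] ρ v t u = trans (ren-[] ρ v (t [ u ])) (cong (ren (liftR ρ) v [_]) (ren-[] ρ t u))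

sub-[[]] : ∀ {m n} (σ : Sub m n) v t u → sub σ (v [ t [ u ] ]) ≡ sub (liftS σ) v [ sub (liftS σ) t [ sub σ u ] ]
sub-[[]] σ v t u = trans (sub-[] σ v (t [ u ])) (cong (sub (liftS σ) v [_]) (sub-[] σ t u))

mutual
  ren-⇉ : ∀ {m n} (ρ : Ren m n) {t t'} → t ⇉ t' → ren ρ t ⇉ ren ρ t'
  ren-⇉ ρ pvar = pvar
  ren-⇉ ρ (plam r) = plam (ren-⇉ (liftR ρ) r)
  ren-⇉ ρ (papp a b c) = papp (ren-⇉ ρ a) (ren-⇉ ρ b) (renC-⇉C ρ c)
  ren-⇉ ρ (pβ₁ {t' = t'} {u' = u'} {v' = v'} a b c) rewrite ren-[[]] ρ v' t' u' =
    pβ₁ (ren-⇉ (liftR ρ) a) (ren-⇉ ρ b) (ren-⇉ (liftR ρ) c)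
  ren-⇉ ρ (pβ₂ {t' = t'} {u' = u'} a b c d) rewrite ren-[] ρ t' u' =
    pβ₂ (ren-⇉ (liftR ρ) a) (ren-⇉ ρ b) (ren-⇉ ρ c) (renC-⇉C ρ d)

  renC-⇉C : ∀ {m n} (ρ : Ren m n) {l l'} → l ⇉C l' → renC ρ l ⇉C renC ρ l'
  renC-⇉C ρ (p∷ a b) = p∷ (ren-⇉ ρ a) (renC-⇉C ρ b)
  renC-⇉C ρ (pabs a) = pabs (ren-⇉ (liftR ρ) a)

liftS-⇉ : ∀ {m n} {σ σ' : Sub m n} → (∀ i → σ i ⇉ σ' i) → ∀ i → liftS σ i ⇉ liftS σ' i
liftS-⇉ r zero = pvar
liftS-⇉ r (suc i) = ren-⇉ suc (r i)

mutual
  sub-⇉ : ∀ {m n} {σ σ' : Sub m n} → (∀ i → σ i ⇉ σ' i) → ∀ {t t'} → t ⇉ t' → sub σ t ⇉ sub σ' t'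
  sub-⇉ r (pvar {i}) = r i
  sub-⇉ r (plam a) = plam (sub-⇉ (liftS-⇉ r) a)
  sub-⇉ r (papp a b c) = papp (sub-⇉ r a) (sub-⇉ r b) (subC-⇉C r c)
  sub-⇉ {σ' = σ'} r (pβ₁ {t' = t'} {u' = u'} {v' = v'} a b c) rewrite sub-[[]] σ' v' t' u' =
    pβ₁ (sub-⇉ (liftS-⇉ r) a) (sub-⇉ r b) (sub-⇉ (liftS-⇉ r) c)
  sub-⇉ {σ' = σ'} r (pβ₂ {t' = t'} {u' = u'} a b c d) rewrite sub-[] σ' t' u' =
    pβ₂ (sub-⇉ (liftS-⇉ r) a) (sub-⇉ r b) (sub-⇉ r c) (subC-⇉C r d)

  subC-⇉C : ∀ {m n} {σ σ' : Sub m n} → (∀ i → σ i ⇉ σ' i) → ∀ {l l'} → l ⇉C l' → subC σ l ⇉C subC σ' l'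
  subC-⇉C r (p∷ a b) = p∷ (sub-⇉ r a) (subC-⇉C r b)
  subC-⇉C r (pabs a) = pabs (sub-⇉ (liftS-⇉ r) a)

[]-⇉ : ∀ {n} {t t' : Tm (suc n)} {u u' : Tm n} → t ⇉ t' → u ⇉ u' → t [ u ] ⇉ t' [ u' ]
[]-⇉ a b = sub-⇉ single-⇉ a
  where
  single-⇉ : ∀ i → single _ i ⇉ single _ i
  single-⇉ zero = b
  single-⇉ (suc i) = pvar

mutual
  ren-⇉-inv : ∀ {m n} (ρ : Ren m n) (t : Tm m) {z} → ren ρ t ⇉ z → ∃ λ t' → z ≡ ren ρ t' × t ⇉ t'
  ren-⇉-inv ρ (var i) pvar = var i , refl , pvar
  ren-⇉-inv ρ (lam t) (plam r) with ren-⇉-inv (liftR ρ) t r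
  ... | t' , refl , r' = lam t' , refl , plam r'
  ren-⇉-inv ρ (app (var i) u l) (papp a b c) = ren-papp-inv ρ (var i) u l a b c
  ren-⇉-inv ρ (app (app t w k) u l) (papp a b c) = ren-papp-inv ρ (app t w k) u l a b c
  ren-⇉-inv ρ (app (lam e) u (abs v)) (papp a b c) = ren-papp-inv ρ (lam e) u (abs v) a b c
  ren-⇉-inv ρ (app (lam e) u (w ∷ l)) (papp a b c) = ren-papp-inv ρ (lam e) u (w ∷ l) a b c
  ren-⇉-inv ρ (app (lam e) u (abs v)) (pβ₁ a b c)
    with ren-⇉-inv (liftR ρ) e a | ren-⇉-inv ρ u b | ren-⇉-inv (liftR ρ) v c
  ... | e' , refl , a' | u' , refl , b' | v' , refl , c' = v' [ e' [ u' ] ] , sym (ren-[[]] ρ v' e' u') , pβ₁ a' b' c'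
  ren-⇉-inv ρ (app (lam e) u (w ∷ l)) (pβ₂ a b c d)
    with ren-⇉-inv (liftR ρ) e a | ren-⇉-inv ρ u b | ren-⇉-inv ρ w c | renC-⇉C-inv ρ l d
  ... | e' , refl , a' | u' , refl , b' | w' , refl , c' | l' , refl , d' =
    app (e' [ u' ]) w' l' , cong (λ x → app x _ _) (sym (ren-[] ρ e' u')) , pβ₂ a' b' c' d'

  ren-papp-inv : ∀ {m n} (ρ : Ren m n) (t u : Tm m) l {t'' u'' l''} →
    ren ρ t ⇉ t'' → ren ρ u ⇉ u'' → renC ρ l ⇉C l'' → ∃ λ z → app t'' u'' l'' ≡ ren ρ z × app t u l ⇉ z
  ren-papp-inv ρ t u l a b c with ren-⇉-inv ρ t a | ren-⇉-inv ρ u b | renC-⇉C-inv ρ l c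
  ... | t' , refl , a' | u' , refl , b' | l' , refl , c' = app t' u' l' , refl , papp a' b' c'

  renC-⇉C-inv : ∀ {m n} (ρ : Ren m n) (l : CoTm m) {z} → renC ρ l ⇉C z → ∃ λ l' → z ≡ renC ρ l' × l ⇉C l'
  renC-⇉C-inv ρ (u ∷ l) (p∷ a b) with ren-⇉-inv ρ u a | renC-⇉C-inv ρ l b
  ... | u' , refl , a' | l' , refl , b' = u' ∷ l' , refl , p∷ a' b'
  renC-⇉C-inv ρ (abs v) (pabs a) with ren-⇉-inv (liftR ρ) v a
  ... | v' , refl , a' = abs v' , refl , pabs a'

mutual
  develop : ∀ {n} → Tm n → Tm n
  develop (var i) = var i
  develop (lam t) = lam (develop t)
  develop (app (lam t) u (abs v)) = develop v [ develop t [ develop u ] ]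
  develop (app (lam t) u (w ∷ l)) = app (develop t [ develop u ]) (develop w) (developC l)
  develop (app (var i) u l) = app (var i) (develop u) (developC l)
  develop (app (app t w k) u l) = app (develop (app t w k)) (develop u) (developC l)

  developC : ∀ {n} → CoTm n → CoTm n
  developC (u ∷ l) = develop u ∷ developC l
  developC (abs v) = abs (develop v)

mutual
  ⇉-develop : ∀ {n} {t t' : Tm n} → t ⇉ t' → t' ⇉ develop t
  ⇉-develop pvar = pvar
  ⇉-develop (plam r) = plam (⇉-develop r)
  ⇉-develop (papp {t = var i} pvar b c) = papp pvar (⇉-develop b) (⇉C-developC c)
  ⇉-develop (papp {t = app _ _ _} a b c) = papp (⇉-develop a) (⇉-develop b) (⇉C-developC c)
  ⇉-develop (papp {t = lam _} (plam a) b (pabs c)) = pβ₁ (⇉-develop a) (⇉-develop b) (⇉-develop c)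
  ⇉-develop (papp {t = lam _} (plam a) b (p∷ c d)) = pβ₂ (⇉-develop a) (⇉-develop b) (⇉-develop c) (⇉C-developC d)
  ⇉-develop (pβ₁ a b c) = []-⇉ (⇉-develop c) ([]-⇉ (⇉-develop a) (⇉-develop b))
  ⇉-develop (pβ₂ a b c d) = papp ([]-⇉ (⇉-develop a) (⇉-develop b)) (⇉-develop c) (⇉C-developC d)

  ⇉C-developC : ∀ {n} {l l' : CoTm n} → l ⇉C l' → l' ⇉C developC l
  ⇉C-developC (p∷ a b) = p∷ (⇉-develop a) (⇉C-developC b)
  ⇉C-developC (pabs a) = pabs (⇉-develop a)

-- Projection of parallel β-reduction onto πμ-normal forms

infix 4 _⇛_ _⇛C_

_⇛_ : ∀ {n} → Tm n → Tm n → Set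
x ⇛ y = ∃ λ c → x ⇉ c × nf c ≡ y

_⇛C_ : ∀ {n} → CoTm n → CoTm n → Set
k ⇛C y = ∃ λ c → k ⇉C c × nfC c ≡ y

μredex-⇉ : ∀ {n} {p : Tm n} {q z} → app (var zero) (wk p) (wkC q) ⇉ z →
  ∃ λ p' → ∃ λ q' → z ≡ app (var zero) (wk p') (wkC q') × p ⇉ p' × q ⇉C q'
μredex-⇉ {p = p} {q} (papp pvar b c) with ren-⇉-inv suc p b | renC-⇉C-inv suc q c
... | p' , refl , b' | q' , refl , c' = p' , q' , refl , b' , c'

absμ-⇉ : ∀ {n} {w z : Tm (suc n)} → w ⇉ z → absμ w ⇛C absμ (nf z)
absμ-⇉ {w = w} r with μredex w in eq
... | nothing = abs _ , pabs r , refl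
... | just (p , q) rewrite μredex-sound w eq with μredex-⇉ r
... | p' , q' , refl , b , c = p' ∷ q' , p∷ b c , sym (nfC-μredex p' q')

β-absμ-⇉ : ∀ {n} {e e' : Tm (suc n)} {b b' : Tm n} {w z : Tm (suc n)} → e ⇉ e' → b ⇉ b' → w ⇉ z →
  app (lam e) b (absμ w) ⇉ z [ e' [ b' ] ]
β-absμ-⇉ {e' = e'} {b' = b'} {w = w} re rb r with μredex w in eq
... | nothing = pβ₁ re rb r
... | just (p , q) rewrite μredex-sound w eq with μredex-⇉ r
... | p' , q' , refl , rp , rq rewrite wk-[] p' (e' [ b' ]) | wkC-[] q' (e' [ b' ]) = pβ₂ re rb rp rq

nf-app-⊕ : ∀ {n} (t w : Tm n) c k u l → nfC c ≡ nfC (k ⊕ (u , l)) → nf (app t w c) ≡ nf (app (app t w k) u l)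
nf-app-⊕ t w c k u l e = trans (cong (appNF (nf t) (nf w)) e) (sym (nf-πμ (π {t = t} {w} {k} {u} {l})))

mutual
  appNF-⇉ : ∀ {n} {t t' u u' : Tm n} {l l'} → t ⇉ t' → u ⇉ u' → l ⇉C l' → appNF t u l ⇛ nf (app t' u' l')
  appNF-⇉ pvar ru rl = _ , papp pvar ru rl , refl
  appNF-⇉ (plam r) ru rl = _ , papp (plam r) ru rl , refl
  appNF-⇉ {u' = u'} {l' = l'} (papp {t' = t'} {u' = w'} {l' = k'} ra rb rk) ru rl with appendNF-⇉ rk ru rl
  ... | c , r , e = app t' w' c , papp ra rb r , nf-app-⊕ t' w' c k' u' l' e
  appNF-⇉ {u' = u'} {l' = l'} (pβ₂ {t' = e'} {u' = b'} {w' = w'} {l' = k'} ra rb rw rk) ru rl with appendNF-⇉ rk ru rl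
  ... | c , r , e = app (e' [ b' ]) w' c , pβ₂ ra rb rw r , nf-app-⊕ (e' [ b' ]) w' c k' u' l' e
  appNF-⇉ {u' = u'} {l' = l'} (pβ₁ {t' = e'} {u' = b'} {v' = v'} ra rb rv) ru rl
    with appNF-⇉ rv (ren-⇉ suc ru) (renC-⇉C suc rl)
  ... | z , rz , ez = z [ e' [ b' ] ] , β-absμ-⇉ ra rb rz , (begin
    nf (z [ e' [ b' ] ])                           ≡⟨ nf-[]-cong {t = z} {app v' (wk u') (wkC l')} {e' [ b' ]} ez refl ⟩
    nf (app v' (wk u') (wkC l') [ e' [ b' ] ])     ≡⟨ cong₂ (λ a b → nf (app (v' [ e' [ b' ] ]) a b)) (wk-[] u' _) (wkC-[] l' _) ⟩
    nf (app (v' [ e' [ b' ] ]) u' l')              ∎)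

  appendNF-⇉ : ∀ {n} {k k' : CoTm n} {u u' l l'} → k ⇉C k' → u ⇉ u' → l ⇉C l' →
    appendNF k u l ⇛C nfC (k' ⊕ (u' , l'))
  appendNF-⇉ (p∷ rw rk) ru rl with appendNF-⇉ rk ru rl
  ... | c , r , e = _ , p∷ rw r , cong (_ ∷_) e
  appendNF-⇉ {u' = u'} {l' = l'} (pabs {v' = v'} rv) ru rl with appNF-⇉ rv (ren-⇉ suc ru) (renC-⇉C suc rl)
  ... | z , rz , ez with absμ-⇉ rz
  ... | c , rc , ec = c , rc , (begin
    nfC c                                               ≡⟨ ec ⟩
    absμ (nf z)                                         ≡⟨ cong absμ ez ⟩
    absμ (appNF (nf v') (nf (wk u')) (nfC (wkC l')))    ≡⟨ cong absμ (sym (nf-appπ v' (wk u') (wkC l'))) ⟩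
    nfC (abs (appπ v' (wk u') (wkC l')))                ≡⟨ cong nfC (sym (abs-⊕ v' u' l')) ⟩
    nfC (abs v' ⊕ (u' , l'))                            ∎)

mutual
  nf-⇉ : ∀ {n} {t t' : Tm n} → t ⇉ t' → nf t ⇛ nf t'
  nf-⇉ pvar = _ , pvar , refl
  nf-⇉ (plam r) with nf-⇉ r
  ... | c , rc , e = lam c , plam rc , cong lam e
  nf-⇉ (papp ra rb rl) with nf-⇉ ra | nf-⇉ rb | nfC-⇉C rl
  ... | _ , r₁ , e₁ | _ , r₂ , e₂ | _ , r₃ , e₃ with appNF-⇉ r₁ r₂ r₃
  ... | c , rc , ec = c , rc , trans ec (cong₃ appNF e₁ e₂ e₃)
  nf-⇉ (pβ₁ {t' = e'} {u' = u'} {v' = v'} ra rb rv) with nf-⇉ ra | nf-⇉ rb | nf-⇉ rv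
  ... | ce , r₁ , e₁ | cu , r₂ , e₂ | cv , r₃ , e₃ =
    _ , β-absμ-⇉ r₁ r₂ r₃ , nf-[]-cong {t = cv} {v'} e₃ (nf-[]-cong {t = ce} {e'} e₁ e₂)
  nf-⇉ (pβ₂ {t' = e'} {u' = u'} ra rb rw rl) with nf-⇉ ra | nf-⇉ rb | nf-⇉ rw | nfC-⇉C rl
  ... | ce , r₁ , e₁ | cu , r₂ , e₂ | _ , r₃ , e₃ | _ , r₄ , e₄ =
    _ , pβ₂ r₁ r₂ r₃ r₄ , cong₃ appNF (nf-[]-cong {t = ce} {e'} e₁ e₂) e₃ e₄

  nfC-⇉C : ∀ {n} {l l' : CoTm n} → l ⇉C l' → nfC l ⇛C nfC l'
  nfC-⇉C (p∷ ra rb) with nf-⇉ ra | nfC-⇉C rb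
  ... | _ , r₁ , e₁ | _ , r₂ , e₂ = _ , p∷ r₁ r₂ , cong₂ _∷_ e₁ e₂
  nfC-⇉C (pabs r) with nf-⇉ r
  ... | _ , rv , ev with absμ-⇉ rv
  ... | c , rc , ec = c , rc , trans ec (cong absμ ev)

-- Confluence

_⟶C*_ : ∀ {n} → CoTm n → CoTm n → Set
_⟶C*_ = Star _⟶C_

lam-⟶* : ∀ {n} {t t' : Tm (suc n)} → t ⟶* t' → lam t ⟶* lam t'
lam-⟶* = gmap lam ξ-lam

app-⟶* : ∀ {n} {t t' u u' : Tm n} {l l'} → t ⟶* t' → u ⟶* u' → l ⟶C* l' → app t u l ⟶* app t' u' l'
app-⟶* {t' = t'} {u} {u'} {l} a b c =
  gmap (λ x → app x u l) ξ-app₁ a ◅◅ gmap (λ x → app t' x l) ξ-app₂ b ◅◅ gmap (app t' u') ξ-app₃ c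

∷-⟶* : ∀ {n} {u u' : Tm n} {l l'} → u ⟶* u' → l ⟶C* l' → (u ∷ l) ⟶C* (u' ∷ l')
∷-⟶* {u' = u'} {l} a b = gmap (_∷ l) ξ-∷₁ a ◅◅ gmap (u' ∷_) ξ-∷₂ b

abs-⟶* : ∀ {n} {v v' : Tm (suc n)} → v ⟶* v' → abs v ⟶C* abs v'
abs-⟶* = gmap abs ξ-abs

mutual
  ⇉⇒⟶* : ∀ {n} {t t' : Tm n} → t ⇉ t' → t ⟶* t'
  ⇉⇒⟶* pvar = ε
  ⇉⇒⟶* (plam r) = lam-⟶* (⇉⇒⟶* r)
  ⇉⇒⟶* (papp a b c) = app-⟶* (⇉⇒⟶* a) (⇉⇒⟶* b) (⇉C⇒⟶C* c)
  ⇉⇒⟶* (pβ₁ a b c) = app-⟶* (lam-⟶* (⇉⇒⟶* a)) (⇉⇒⟶* b) (abs-⟶* (⇉⇒⟶* c)) ◅◅ return β₁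
  ⇉⇒⟶* (pβ₂ a b c d) = app-⟶* (lam-⟶* (⇉⇒⟶* a)) (⇉⇒⟶* b) (∷-⟶* (⇉⇒⟶* c) (⇉C⇒⟶C* d)) ◅◅ return β₂

  ⇉C⇒⟶C* : ∀ {n} {l l' : CoTm n} → l ⇉C l' → l ⟶C* l'
  ⇉C⇒⟶C* (p∷ a b) = ∷-⟶* (⇉⇒⟶* a) (⇉C⇒⟶C* b)
  ⇉C⇒⟶C* (pabs a) = abs-⟶* (⇉⇒⟶* a)

mutual
  ⟶πμ⇒⟶ : ∀ {n} {t t' : Tm n} → t ⟶πμ t' → t ⟶ t'
  ⟶πμ⇒⟶ π = π
  ⟶πμ⇒⟶ (ξ-lam r) = ξ-lam (⟶πμ⇒⟶ r)
  ⟶πμ⇒⟶ (ξ-app₁ r) = ξ-app₁ (⟶πμ⇒⟶ r)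
  ⟶πμ⇒⟶ (ξ-app₂ r) = ξ-app₂ (⟶πμ⇒⟶ r)
  ⟶πμ⇒⟶ (ξ-app₃ r) = ξ-app₃ (⟶πμC⇒⟶C r)

  ⟶πμC⇒⟶C : ∀ {n} {l l' : CoTm n} → l ⟶πμC l' → l ⟶C l'
  ⟶πμC⇒⟶C μ = μ
  ⟶πμC⇒⟶C (ξ-∷₁ r) = ξ-∷₁ (⟶πμ⇒⟶ r)
  ⟶πμC⇒⟶C (ξ-∷₂ r) = ξ-∷₂ (⟶πμC⇒⟶C r)
  ⟶πμC⇒⟶C (ξ-abs r) = ξ-abs (⟶πμ⇒⟶ r)

⟶πμ*⇒⟶* : ∀ {n} {t t' : Tm n} → t ⟶πμ* t' → t ⟶* t'
⟶πμ*⇒⟶* = gmap id ⟶πμ⇒⟶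

mutual
  ⟶⇒⇉⊎⟶πμ : ∀ {n} {t t' : Tm n} → t ⟶ t' → (t ⇉ t') ⊎ (t ⟶πμ t')
  ⟶⇒⇉⊎⟶πμ (β₁ {t} {u} {v}) = inj₁ (pβ₁ (⇉-refl t) (⇉-refl u) (⇉-refl v))
  ⟶⇒⇉⊎⟶πμ (β₂ {t} {u} {v} {l}) = inj₁ (pβ₂ (⇉-refl t) (⇉-refl u) (⇉-refl v) (⇉C-refl l))
  ⟶⇒⇉⊎⟶πμ π = inj₂ π
  ⟶⇒⇉⊎⟶πμ (ξ-lam r) = map⊎ plam ξ-lam (⟶⇒⇉⊎⟶πμ r)
  ⟶⇒⇉⊎⟶πμ (ξ-app₁ {u = u} {l} r) = map⊎ (λ p → papp p (⇉-refl u) (⇉C-refl l)) ξ-app₁ (⟶⇒⇉⊎⟶πμ r)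
  ⟶⇒⇉⊎⟶πμ (ξ-app₂ {t} {l = l} r) = map⊎ (λ p → papp (⇉-refl t) p (⇉C-refl l)) ξ-app₂ (⟶⇒⇉⊎⟶πμ r)
  ⟶⇒⇉⊎⟶πμ (ξ-app₃ {t} {u} r) = map⊎ (papp (⇉-refl t) (⇉-refl u)) ξ-app₃ (⟶C⇒⇉C⊎⟶πμC r)

  ⟶C⇒⇉C⊎⟶πμC : ∀ {n} {l l' : CoTm n} → l ⟶C l' → (l ⇉C l') ⊎ (l ⟶πμC l')
  ⟶C⇒⇉C⊎⟶πμC μ = inj₂ μ
  ⟶C⇒⇉C⊎⟶πμC (ξ-∷₁ {l = l} r) = map⊎ (λ p → p∷ p (⇉C-refl l)) ξ-∷₁ (⟶⇒⇉⊎⟶πμ r)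
  ⟶C⇒⇉C⊎⟶πμC (ξ-∷₂ {u} r) = map⊎ (p∷ (⇉-refl u)) ξ-∷₂ (⟶C⇒⇉C⊎⟶πμC r)
  ⟶C⇒⇉C⊎⟶πμC (ξ-abs r) = map⊎ pabs ξ-abs (⟶⇒⇉⊎⟶πμ r)

⇛-diamond : ∀ {n} → Diamond (_⇛_ {n})
⇛-diamond {x = x} (c₁ , r₁ , refl) (c₂ , r₂ , refl) = nf (develop x) , nf-⇉ (⇉-develop r₁) , nf-⇉ (⇉-develop r₂)

nf-⟶* : ∀ {n} {t t' : Tm n} → t ⟶* t' → Star _⇛_ (nf t) (nf t')
nf-⟶* ε = ε
nf-⟶* (r ◅ rs) with ⟶⇒⇉⊎⟶πμ r
... | inj₁ p = nf-⇉ p ◅ nf-⟶* rs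
... | inj₂ q rewrite nf-πμ q = nf-⟶* rs

⇛*⇒⟶* : ∀ {n} {x y : Tm n} → Star _⇛_ x y → x ⟶* y
⇛*⇒⟶* ε = ε
⇛*⇒⟶* ((c , r , refl) ◅ ss) = ⇉⇒⟶* r ◅◅ ⟶πμ*⇒⟶* (⟶πμ*nf c) ◅◅ ⇛*⇒⟶* ss

theorem3p3 : Confluent
theorem3p3 {t₁ = t₁} {t₂} r₁ r₂ with diamond⇒confluent ⇛-diamond (nf-⟶* r₁) (nf-⟶* r₂)
... | z , s₁ , s₂ = z , ⟶πμ*⇒⟶* (⟶πμ*nf t₁) ◅◅ ⇛*⇒⟶* s₁ , ⟶πμ*⇒⟶* (⟶πμ*nf t₂) ◅◅ ⇛*⇒⟶* s₂
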